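{- For all nonnegative integers $n$ and $\beta$, the integer $n^2+n+\beta+1$ has no positive divisor congruent to $3\beta+2$ modulo $4\beta+3$. -}

-- Put M = 4β + 3 and s = 2n + 1, so that 4 (n² + n + β + 1) = s² + M, and suppose d ≡ 3β + 2 (mod M),
-- i.e. 4d ≡ −1 (mod M). Write d = 2^j d′ with d′ odd. As d′ ∣ s² + M, −M is a square modulo d′, so
-- (M/d′) = (−1/d′), and Jacobi reciprocity (M ≡ 3 mod 4) turns this into (d′/M) = 1. Hence
-- −1 = (−1/M) = (4d/M) = (2/M)^j. If β is odd then M ≡ 7 (mod 8) and (2/M) = 1; if β is even then
-- n² + n + β + 1 is odd, so j = 0. Jacobi symbols are computed by Gauss's lemma; multiplicativity comes
-- from the permutation k ↦ ±ak of [1, (M−1)/2] and reciprocity from Eisenstein's lattice-point count.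

module Submission where

open import Data.Nat
open import Data.Nat.Properties
open import Data.Nat.DivMod
open import Data.Nat.Tactic.RingSolver using (solve-∀)
open import Data.Nat.Divisibility
open import Data.Nat.Coprimality using (Coprime; coprime-divisor; 1-coprimeTo) renaming (sym to coprime-sym)
open import Data.Fin using (Fin; zero; suc; toℕ; fromℕ<; punchOut) renaming (_≟_ to _≟ᶠ_)
open import Data.Fin.Properties using (any?; toℕ<n; toℕ-fromℕ<; toℕ-injective; injective⇒≤; punchOut-injective)
open import Data.Fin.Permutation using (Permutation; permutation)
open import Data.Parity.Base as ℙ using (Parity; 0ℙ; 1ℙ)
import Data.Parity.Properties as ℙ
open import Data.Bool using (Bool; true; false)
open import Data.Product using (∃; ∃₂; _×_; _,_; proj₁; proj₂)
open import Data.Sum using (_⊎_; inj₁; inj₂)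
open import Data.Nat.Induction using (<-rec)
open import Function using (_∘_; Injective)
open import Relation.Nullary using (¬_; Dec; yes; no; does; contradiction)
open import Relation.Nullary.Decidable using (dec-true; dec-false)
open import Relation.Binary.PropositionalEquality
import Algebra.Properties.CommutativeMonoid.Sum as Sum

open Sum +-0-commutativeMonoid using (sum-syntax; sum-cong-≗; ∑-distrib-+; ∑-comm)
module ℙΣ = Sum ℙ.+-0-commutativeMonoid

ℙ∑-syntax : ∀ m → (Fin m → Parity) → Parity
ℙ∑-syntax _ = ℙΣ.sum

syntax ℙ∑-syntax m (λ i → x) = ℙ∑[ i < m ] x

injective⇒surjective : ∀ {n} (f : Fin n → Fin n) → Injective _≡_ _≡_ f → ∀ i → ∃ λ j → f j ≡ i
injective⇒surjective {suc n} f f-inj i with any? (λ j → f j ≟ᶠ i)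
... | yes hit = hit
... | no miss = contradiction (injective⇒≤ missing-inj) 1+n≰n
  where
  i≢f : ∀ j → i ≢ f j
  i≢f j i≡fj = miss (j , sym i≡fj)
  missing : Fin (suc n) → Fin n
  missing j = punchOut (i≢f j)
  missing-inj : Injective _≡_ _≡_ missing
  missing-inj {j} {k} = f-inj ∘ punchOut-injective (i≢f j) (i≢f k)

injective⇒permutation : ∀ {n} (f : Fin n → Fin n) → Injective _≡_ _≡_ f → Permutation n n
injective⇒permutation {n} f f-inj = permutation f preimage (λ i → proj₂ (onto i)) (λ j → f-inj (proj₂ (onto (f j))))
  where
  onto : ∀ i → ∃ λ j → f j ≡ i
  onto = injective⇒surjective f f-inj
  preimage : Fin n → Fin n
  preimage i = proj₁ (onto i)

_∈[1,_] : ℕ → ℕ → Set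
x ∈[1, m ] = 1 ≤ x × x ≤ m

⟨_⟩ : ∀ {m} → Fin m → ℕ
⟨ i ⟩ = suc (toℕ i)

⟨⟩-∈ : ∀ {m} (i : Fin m) → ⟨ i ⟩ ∈[1, m ]
⟨⟩-∈ i = s≤s z≤n , toℕ<n i

⟨⟩-injective : ∀ {m} {i j : Fin m} → ⟨ i ⟩ ≡ ⟨ j ⟩ → i ≡ j
⟨⟩-injective = toℕ-injective ∘ suc-injective

fromRange : ∀ {x m} → x ∈[1, m ] → Fin m
fromRange {suc x} (_ , x<m) = fromℕ< x<m

⟨fromRange⟩ : ∀ {x m} (x∈ : x ∈[1, m ]) → ⟨ fromRange x∈ ⟩ ≡ x
⟨fromRange⟩ {suc x} (_ , x<m) = cong suc (toℕ-fromℕ< x<m)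

𝟙 : Bool → ℕ
𝟙 true = 1
𝟙 false = 0

𝟙-cong : {P Q : Set} → (P → Q) → (Q → P) → (P? : Dec P) (Q? : Dec Q) → 𝟙 (does P?) ≡ 𝟙 (does Q?)
𝟙-cong P→Q Q→P (yes p) (yes q) = refl
𝟙-cong P→Q Q→P (yes p) (no ¬q) = contradiction (P→Q p) ¬q
𝟙-cong P→Q Q→P (no ¬p) (yes q) = contradiction (Q→P q) ¬p
𝟙-cong P→Q Q→P (no ¬p) (no ¬q) = refl

𝟙-complement : {P Q : Set} → (P → ¬ Q) → (¬ P → Q) → (P? : Dec P) (Q? : Dec Q) → 𝟙 (does P?) + 𝟙 (does Q?) ≡ 1
𝟙-complement P→¬Q ¬P→Q (yes p) (yes q) = contradiction q (P→¬Q p)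
𝟙-complement P→¬Q ¬P→Q (yes p) (no ¬q) = refl
𝟙-complement P→¬Q ¬P→Q (no ¬p) (yes q) = refl
𝟙-complement P→¬Q ¬P→Q (no ¬p) (no ¬q) = contradiction (¬P→Q ¬p) ¬q

∑-const : ∀ m c → ∑[ i < m ] c ≡ m * c
∑-const zero c = refl
∑-const (suc m) c = cong (c +_) (∑-const m c)

count-≤ : ∀ {m} q → q ≤ m → ∑[ i < m ] 𝟙 (does (⟨ i ⟩ ≤? q)) ≡ q
count-≤ {m} zero _ = trans (∑-const m 0) (*-zeroʳ m)
count-≤ {suc m} (suc q) (s≤s q≤m) = cong suc (count-≤ q q≤m)

parity-∑ : ∀ {m} (f : Fin m → ℕ) → parity (∑[ i < m ] f i) ≡ ℙ∑[ i < m ] parity (f i)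
parity-∑ {zero} f = refl
parity-∑ {suc m} f = trans (ℙ.+-homo-+ (f zero) _) (cong (parity (f zero) ℙ.+_) (parity-∑ (f ∘ suc)))

p+q≡r⇒p≡r+q : ∀ p q r → p ℙ.+ q ≡ r → p ≡ r ℙ.+ q
p+q≡r⇒p≡r+q 0ℙ 0ℙ r refl = refl
p+q≡r⇒p≡r+q 0ℙ 1ℙ r refl = refl
p+q≡r⇒p≡r+q 1ℙ 0ℙ r refl = refl
p+q≡r⇒p≡r+q 1ℙ 1ℙ r refl = refl

s≡s+j+q⇒j≡q : ∀ s j q → s ≡ s ℙ.+ j ℙ.+ q → j ≡ q
s≡s+j+q⇒j≡q s j q eq = p+q≡r⇒p≡r+q j q 0ℙ (ℙ.+-cancelˡ-≡ s (j ℙ.+ q) 0ℙ (begin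
  s ℙ.+ (j ℙ.+ q) ≡⟨ ℙ.+-assoc s j q ⟨
  s ℙ.+ j ℙ.+ q   ≡⟨ eq ⟨
  s               ≡⟨ ℙ.+-identityʳ s ⟨
  s ℙ.+ 0ℙ        ∎))
  where open ≡-Reasoning

parity-double : ∀ m → parity (m + m) ≡ 0ℙ
parity-double m = trans (ℙ.+-homo-+ m m) (ℙ.p+p≡0ℙ (parity m))

coprime⇒∤* : ∀ {a n x} → Coprime a n → 0 < x → x < n → n ∤ a * x
coprime⇒∤* {x = suc _} a⊥n _ x<n n∣ax = <⇒≱ x<n (∣⇒≤ (coprime-divisor (coprime-sym a⊥n) n∣ax))

%≡%⇒∣∸ : ∀ {n} .{{_ : NonZero n}} {x y} → x % n ≡ y % n → n ∣ y ∸ x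
%≡%⇒∣∸ {n} {x} {y} eq = divides (y / n ∸ x / n) (begin
  y ∸ x                                   ≡⟨ cong₂ _∸_ (m≡m%n+[m/n]*n y n) (m≡m%n+[m/n]*n x n) ⟩
  (y % n + y / n * n) ∸ (x % n + x / n * n) ≡⟨ cong (λ r → (y % n + y / n * n) ∸ (r + x / n * n)) eq ⟩
  (y % n + y / n * n) ∸ (y % n + x / n * n) ≡⟨ [m+n]∸[m+o]≡n∸o (y % n) _ _ ⟩
  y / n * n ∸ x / n * n                   ≡⟨ *-distribʳ-∸ n (y / n) (x / n) ⟨
  (y / n ∸ x / n) * n                     ∎)
  where open ≡-Reasoning

%≡0⇒≡n : ∀ {n t} .{{_ : NonZero n}} → 0 < t → t < n + n → t % n ≡ 0 → t ≡ n
%≡0⇒≡n {n} {t} 0<t t<2n t%n≡0 with m%n≡0⇒n∣m t n t%n≡0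
... | divides 0 t≡0 = contradiction (sym t≡0) (<⇒≢ 0<t)
... | divides 1 t≡n = trans t≡n (+-identityʳ n)
... | divides (suc (suc q)) t≡q*n =
  contradiction (subst (n + n ≤_) (sym t≡q*n) (+-monoʳ-≤ n (m≤m+n n (q * n)))) (<⇒≱ t<2n)

coprime-* : ∀ {a b n} → Coprime a n → Coprime b n → Coprime (a * b) n
coprime-* {a} a⊥n b⊥n (g∣ab , g∣n) = b⊥n (coprime-divisor g⊥a g∣ab , g∣n)
  where
  g⊥a : Coprime _ a
  g⊥a (e∣g , e∣a) = a⊥n (e∣a , ∣-trans e∣g g∣n)

coprime-^ : ∀ {a n} → Coprime a n → ∀ i → Coprime (a ^ i) n
coprime-^ {n = n} a⊥n zero = 1-coprimeTo n
coprime-^ a⊥n (suc i) = coprime-* a⊥n (coprime-^ a⊥n i)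

∣m∧n∣1+m⇒coprime : ∀ {y m n} → y ∣ m → n ∣ suc m → Coprime y n
∣m∧n∣1+m⇒coprime {m = m} y∣m n∣m+1 {g} (g∣y , g∣n) =
  ∣1⇒≡1 (∣m+n∣m⇒∣n (subst (g ∣_) (+-comm 1 m) (∣-trans g∣n n∣m+1)) (∣-trans g∣y y∣m))

m*[n%o]%o≡m*n%o : ∀ m n o .{{_ : NonZero o}} → m * (n % o) % o ≡ m * n % o
m*[n%o]%o≡m*n%o m n o = begin
  m * (n % o) % o           ≡⟨ %-distribˡ-* m (n % o) o ⟩
  m % o * (n % o % o) % o   ≡⟨ cong (λ r → m % o * r % o) (m%n%n≡m%n n o) ⟩
  m % o * (n % o) % o       ≡⟨ %-distribˡ-* m n o ⟨
  m * n % o                 ∎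
  where open ≡-Reasoning

-- jacobi a is the Jacobi symbol (a / 2h+1) written additively (1ℙ for −1), defined through Gauss's
-- lemma as the parity of the number of k ∈ [1, h] for which a k mod (2h + 1) exceeds h.
module GaussLemma (h : ℕ) where

  n : ℕ
  n = suc (h + h)

  residue : ℕ → ℕ → ℕ
  residue a x = a * x % n

  absLeast : ℕ → ℕ
  absLeast r with h <? r
  ... | yes _ = n ∸ r
  ... | no _ = r

  upper : ℕ → ℕ
  upper r with h <? r
  ... | yes _ = 1
  ... | no _ = 0

  gaussCount : ℕ → ℕ
  gaussCount a = ∑[ k < h ] upper (residue a ⟨ k ⟩)

  jacobi : ℕ → Parity
  jacobi a = parity (gaussCount a)

  ε : ℕ → ℕ → Parity
  ε a x = parity (upper (residue a x))

  ∈⇒<n : ∀ {x} → x ∈[1, h ] → x < n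
  ∈⇒<n (_ , x≤h) = s≤s (≤-trans x≤h (m≤m+n h h))

  n∸[1+h]≡h : n ∸ suc h ≡ h
  n∸[1+h]≡h = m+n∸m≡n h h

  parity-n : parity n ≡ 1ℙ
  parity-n = trans (ℙ.+-homo-+ 1 (h + h)) (cong (1ℙ ℙ.+_) (parity-double h))

  upper-𝟙 : ∀ r → upper r ≡ 𝟙 (does (h <? r))
  upper-𝟙 r with h <? r
  ... | yes h<r = cong 𝟙 (sym (dec-true (h <? r) h<r))
  ... | no h≮r = cong 𝟙 (sym (dec-false (h <? r) h≮r))

  upper-low : ∀ {r} → r ≤ h → upper r ≡ 0
  upper-low {r} r≤h with h <? r
  ... | yes h<r = contradiction h<r (≤⇒≯ r≤h)
  ... | no _ = refl

  upper-complement : ∀ r s → r + s ≡ n → upper r + upper s ≡ 1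
  upper-complement r s r+s≡n with h <? r | h <? s
  ... | yes _ | no _ = refl
  ... | no _ | yes _ = refl
  ... | yes h<r | yes h<s =
    contradiction (+-cancelˡ-≤ h (suc h) h (s≤s⁻¹ (subst (suc h + suc h ≤_) r+s≡n (+-mono-≤ h<r h<s)))) (n≮n h)
  ... | no h≮r | no h≮s = contradiction (≤-reflexive (sym r+s≡n)) (<⇒≱ (s≤s (+-mono-≤ (≮⇒≥ h≮r) (≮⇒≥ h≮s))))

  jacobi-∑ : ∀ a → jacobi a ≡ ℙ∑[ k < h ] ε a ⟨ k ⟩
  jacobi-∑ a = parity-∑ {h} (λ k → upper (residue a ⟨ k ⟩))

  residue-pos : ∀ {a x} → Coprime a n → 0 < x → x < n → 0 < residue a x
  residue-pos {a} {x} a⊥n 0<x x<n = n≢0⇒n>0 λ r≡0 → coprime⇒∤* a⊥n 0<x x<n (m%n≡0⇒n∣m (a * x) n r≡0)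

  residue-mod : ∀ {a b} x → a % n ≡ b % n → residue a x ≡ residue b x
  residue-mod {a} {b} x a≡b = begin
    a * x % n             ≡⟨ %-distribˡ-* a x n ⟩
    a % n * (x % n) % n   ≡⟨ cong (λ r → r * (x % n) % n) a≡b ⟩
    b % n * (x % n) % n   ≡⟨ %-distribˡ-* b x n ⟨
    b * x % n             ∎
    where open ≡-Reasoning

  residue-∘ : ∀ a b x → residue (a * b) x ≡ residue b (residue a x)
  residue-∘ a b x = begin
    a * b * x % n     ≡⟨ cong (_% n) (trans (cong (_* x) (*-comm a b)) (*-assoc b a x)) ⟩
    b * (a * x) % n   ≡⟨ m*[n%o]%o≡m*n%o b (a * x) n ⟨
    b * (a * x % n) % n ∎
    where open ≡-Reasoning

  residue-complement : ∀ {b r} → Coprime b n → 0 < r → r < n → residue b r + residue b (n ∸ r) ≡ n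
  residue-complement {b} {r} b⊥n 0<r r<n =
    %≡0⇒≡n (≤-trans (residue-pos b⊥n 0<r r<n) (m≤m+n _ _)) (+-mono-< (m%n<n (b * r) n) (m%n<n (b * (n ∸ r)) n)) (begin
      (residue b r + residue b (n ∸ r)) % n ≡⟨ %-distribˡ-+ (b * r) (b * (n ∸ r)) n ⟨
      (b * r + b * (n ∸ r)) % n             ≡⟨ cong (_% n) (*-distribˡ-+ b r (n ∸ r)) ⟨
      b * (r + (n ∸ r)) % n                 ≡⟨ cong (λ m → b * m % n) (m+[n∸m]≡n (<⇒≤ r<n)) ⟩
      b * n % n                             ≡⟨ m*n%n≡0 b n ⟩
      0                                     ∎)
    where open ≡-Reasoning

  residue-minus-one : ∀ {x} → x ∈[1, h ] → residue (h + h) x + x ≡ n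
  residue-minus-one {x} (1≤x , x≤h) = %≡0⇒≡n (≤-trans 1≤x (m≤n+m x _)) (+-mono-< (m%n<n ((h + h) * x) n) x<n) (begin
    (residue (h + h) x + x) % n      ≡⟨ cong (λ y → (residue (h + h) x + y) % n) (m<n⇒m%n≡m x<n) ⟨
    (residue (h + h) x + x % n) % n  ≡⟨ %-distribˡ-+ ((h + h) * x) x n ⟨
    ((h + h) * x + x) % n            ≡⟨ cong (_% n) (trans (+-comm _ x) (*-comm n x)) ⟩
    x * n % n                        ≡⟨ m*n%n≡0 x n ⟩
    0                                ∎)
    where
    open ≡-Reasoning
    x<n : x < n
    x<n = ∈⇒<n (1≤x , x≤h)

  residue-≡⇒≤ : ∀ {a x y} → Coprime a n → y < n → residue a x ≡ residue a y → y ≤ x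
  residue-≡⇒≤ {a} {x} {y} a⊥n y<n rx≡ry with y ≤? x
  ... | yes y≤x = y≤x
  ... | no y≰x = contradiction (subst (n ∣_) (sym (*-distribˡ-∸ a y x)) (%≡%⇒∣∸ {x = a * x} {a * y} rx≡ry))
                   (coprime⇒∤* a⊥n (m<n⇒0<n∸m (≰⇒> y≰x)) (≤-<-trans (m∸n≤m y x) y<n))

  residue-injective : ∀ {a x y} → Coprime a n → x ∈[1, h ] → y ∈[1, h ] → residue a x ≡ residue a y → x ≡ y
  residue-injective a⊥n x∈ y∈ rx≡ry =
    ≤-antisym (residue-≡⇒≤ a⊥n (∈⇒<n x∈) (sym rx≡ry)) (residue-≡⇒≤ a⊥n (∈⇒<n y∈) rx≡ry)

  residue-+≢n : ∀ {a x y} → Coprime a n → x ∈[1, h ] → y ∈[1, h ] → residue a x + residue a y ≢ n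
  residue-+≢n {a} {x} {y} a⊥n (1≤x , x≤h) (_ , y≤h) rx+ry≡n =
    coprime⇒∤* a⊥n (≤-trans 1≤x (m≤m+n x y)) (s≤s (+-mono-≤ x≤h y≤h)) (m%n≡0⇒n∣m (a * (x + y)) n (begin
      a * (x + y) % n                 ≡⟨ cong (_% n) (*-distribˡ-+ a x y) ⟩
      (a * x + a * y) % n             ≡⟨ %-distribˡ-+ (a * x) (a * y) n ⟩
      (residue a x + residue a y) % n ≡⟨ cong (_% n) rx+ry≡n ⟩
      n % n                           ≡⟨ n%n≡0 n ⟩
      0                               ∎))
    where open ≡-Reasoning

  absLeast-∈ : ∀ {r} → 0 < r → r < n → absLeast r ∈[1, h ]
  absLeast-∈ {r} 0<r r<n with h <? r
  ... | yes h<r = m<n⇒0<n∸m r<n , subst (n ∸ r ≤_) n∸[1+h]≡h (∸-monoʳ-≤ n h<r)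
  ... | no h≮r = 0<r , ≮⇒≥ h≮r

  absLeast-residue-∈ : ∀ {a x} → Coprime a n → x ∈[1, h ] → absLeast (residue a x) ∈[1, h ]
  absLeast-residue-∈ {a} {x} a⊥n x∈ = absLeast-∈ (residue-pos a⊥n (proj₁ x∈) (∈⇒<n x∈)) (m%n<n (a * x) n)

  absLeast-residue-injective : ∀ {a x y} → Coprime a n → x ∈[1, h ] → y ∈[1, h ] →
                               absLeast (residue a x) ≡ absLeast (residue a y) → x ≡ y
  absLeast-residue-injective {a} {x} {y} a⊥n x∈ y∈ eq with h <? residue a x | h <? residue a y
  ... | no _ | no _ = residue-injective a⊥n x∈ y∈ eq
  ... | yes _ | yes _ = residue-injective a⊥n x∈ y∈ (∸-cancelˡ-≡ (rx≤n x) (rx≤n y) eq)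
    where
    rx≤n : ∀ z → residue a z ≤ n
    rx≤n z = <⇒≤ (m%n<n (a * z) n)
  ... | yes _ | no _ = contradiction (trans (cong (residue a x +_) (sym eq)) (m+[n∸m]≡n (<⇒≤ (m%n<n (a * x) n))))
                                     (residue-+≢n a⊥n x∈ y∈)
  ... | no _ | yes _ = contradiction (trans (cong (residue a y +_) eq) (m+[n∸m]≡n (<⇒≤ (m%n<n (a * y) n))))
                                     (residue-+≢n a⊥n y∈ x∈)

  ∑-absLeast-residue : ∀ {a} → Coprime a n → (g : ℕ → Parity) →
                       ℙ∑[ k < h ] g (absLeast (residue a ⟨ k ⟩)) ≡ ℙ∑[ k < h ] g ⟨ k ⟩
  ∑-absLeast-residue {a} a⊥n g = begin
    ℙ∑[ k < h ] g (absLeast (residue a ⟨ k ⟩)) ≡⟨ ℙΣ.sum-cong-≗ (λ k → cong g (⟨fromRange⟩ (σ-∈ k))) ⟨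
    ℙ∑[ k < h ] g ⟨ σ k ⟩                      ≡⟨ ℙΣ.∑-permute (g ∘ ⟨_⟩) (injective⇒permutation σ σ-injective) ⟨
    ℙ∑[ k < h ] g ⟨ k ⟩                        ∎
    where
    open ≡-Reasoning
    σ-∈ : ∀ k → absLeast (residue a ⟨ k ⟩) ∈[1, h ]
    σ-∈ k = absLeast-residue-∈ a⊥n (⟨⟩-∈ k)
    σ : Fin h → Fin h
    σ k = fromRange (σ-∈ k)
    σ-injective : Injective _≡_ _≡_ σ
    σ-injective {k} {l} σk≡σl = ⟨⟩-injective (absLeast-residue-injective a⊥n (⟨⟩-∈ k) (⟨⟩-∈ l) (begin
      absLeast (residue a ⟨ k ⟩) ≡⟨ ⟨fromRange⟩ (σ-∈ k) ⟨
      ⟨ σ k ⟩                    ≡⟨ cong ⟨_⟩ σk≡σl ⟩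
      ⟨ σ l ⟩                    ≡⟨ ⟨fromRange⟩ (σ-∈ l) ⟩
      absLeast (residue a ⟨ l ⟩) ∎))

  parity-absLeast : ∀ r → r ≤ n → parity r ≡ parity (absLeast r) ℙ.+ parity (upper r)
  parity-absLeast r r≤n with h <? r
  ... | no _ = sym (ℙ.+-identityʳ (parity r))
  ... | yes _ = trans (p+q≡r⇒p≡r+q (parity r) (parity (n ∸ r)) 1ℙ (begin
    parity r ℙ.+ parity (n ∸ r) ≡⟨ ℙ.+-homo-+ r (n ∸ r) ⟨
    parity (r + (n ∸ r))        ≡⟨ cong parity (m+[n∸m]≡n r≤n) ⟩
    parity n                    ≡⟨ parity-n ⟩
    1ℙ                          ∎)) (ℙ.+-comm 1ℙ (parity (n ∸ r)))
    where open ≡-Reasoning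

  jacobi-mod : ∀ {a b} → a % n ≡ b % n → jacobi a ≡ jacobi b
  jacobi-mod {a} {b} a≡b = cong parity (sum-cong-≗ {h} (λ k → cong upper (residue-mod {a} {b} ⟨ k ⟩ a≡b)))

  ε-* : ∀ {a b x} → Coprime a n → Coprime b n → x ∈[1, h ] → ε (a * b) x ≡ ε a x ℙ.+ ε b (absLeast (residue a x))
  ε-* {a} {b} {x} a⊥n b⊥n x∈ rewrite residue-∘ a b x with h <? residue a x
  ... | no _ = refl
  ... | yes _ = p+q≡r⇒p≡r+q (ε b r) (ε b (n ∸ r)) 1ℙ (begin
    ε b r ℙ.+ ε b (n ∸ r)        ≡⟨ ℙ.+-homo-+ (upper R) (upper R′) ⟨
    parity (upper R + upper R′)  ≡⟨ cong parity (upper-complement R R′ R+R′≡n) ⟩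
    1ℙ                           ∎)
    where
    open ≡-Reasoning
    r R R′ : ℕ
    r = residue a x
    R = residue b r
    R′ = residue b (n ∸ r)
    R+R′≡n : R + R′ ≡ n
    R+R′≡n = residue-complement b⊥n (residue-pos a⊥n (proj₁ x∈) (∈⇒<n x∈)) (m%n<n (a * x) n)

  jacobi-* : ∀ {a b} → Coprime a n → Coprime b n → jacobi (a * b) ≡ jacobi a ℙ.+ jacobi b
  jacobi-* {a} {b} a⊥n b⊥n = begin
    jacobi (a * b)
      ≡⟨ jacobi-∑ (a * b) ⟩
    ℙ∑[ k < h ] ε (a * b) ⟨ k ⟩
      ≡⟨ ℙΣ.sum-cong-≗ (λ k → ε-* a⊥n b⊥n (⟨⟩-∈ k)) ⟩
    ℙ∑[ k < h ] (ε a ⟨ k ⟩ ℙ.+ ε b (absLeast (residue a ⟨ k ⟩)))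
      ≡⟨ ℙΣ.∑-distrib-+ {h} (ε a ∘ ⟨_⟩) (λ k → ε b (absLeast (residue a ⟨ k ⟩))) ⟩
    ℙ∑[ k < h ] ε a ⟨ k ⟩ ℙ.+ ℙ∑[ k < h ] ε b (absLeast (residue a ⟨ k ⟩))
      ≡⟨ cong (ℙ∑[ k < h ] ε a ⟨ k ⟩ ℙ.+_) (∑-absLeast-residue a⊥n (ε b)) ⟩
    ℙ∑[ k < h ] ε a ⟨ k ⟩ ℙ.+ ℙ∑[ k < h ] ε b ⟨ k ⟩
      ≡⟨ cong₂ ℙ._+_ (jacobi-∑ a) (jacobi-∑ b) ⟨
    jacobi a ℙ.+ jacobi b
      ∎
    where open ≡-Reasoning

  jacobi-1 : jacobi 1 ≡ 0ℙ
  jacobi-1 = cong parity (begin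
    ∑[ k < h ] upper (residue 1 ⟨ k ⟩) ≡⟨ sum-cong-≗ (λ k → upper-low (residue-low (⟨⟩-∈ k))) ⟩
    ∑[ k < h ] 0                      ≡⟨ ∑-const h 0 ⟩
    h * 0                             ≡⟨ *-zeroʳ h ⟩
    0                                 ∎)
    where
    open ≡-Reasoning
    residue-low : ∀ {x} → x ∈[1, h ] → residue 1 x ≤ h
    residue-low {x} x∈ = subst (_≤ h) (sym (trans (cong (_% n) (*-identityˡ x)) (m<n⇒m%n≡m (∈⇒<n x∈)))) (proj₂ x∈)

  jacobi-^ : ∀ {b} → Coprime b n → ∀ i → jacobi (b ^ i) ≡ parity i ℙ.* jacobi b
  jacobi-^ b⊥n zero = jacobi-1
  jacobi-^ {b} b⊥n (suc i) = begin
    jacobi (b * b ^ i)                              ≡⟨ jacobi-* b⊥n (coprime-^ b⊥n i) ⟩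
    jacobi b ℙ.+ jacobi (b ^ i)                     ≡⟨ cong (jacobi b ℙ.+_) (jacobi-^ b⊥n i) ⟩
    jacobi b ℙ.+ (parity i ℙ.* jacobi b)            ≡⟨ ℙ.*-distribʳ-+ (jacobi b) 1ℙ (parity i) ⟨
    (1ℙ ℙ.+ parity i) ℙ.* jacobi b                  ≡⟨ cong (ℙ._* jacobi b) (ℙ.+-homo-+ 1 i) ⟨
    parity (suc i) ℙ.* jacobi b                     ∎
    where open ≡-Reasoning

  jacobi-minus-one : jacobi (h + h) ≡ parity h
  jacobi-minus-one = cong parity (begin
    ∑[ k < h ] upper (residue (h + h) ⟨ k ⟩) ≡⟨ sum-cong-≗ (λ k → upper-high (⟨⟩-∈ k)) ⟩
    ∑[ k < h ] 1                            ≡⟨ ∑-const h 1 ⟩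
    h * 1                                   ≡⟨ *-identityʳ h ⟩
    h                                       ∎)
    where
    open ≡-Reasoning
    upper-high : ∀ {x} → x ∈[1, h ] → upper (residue (h + h) x) ≡ 1
    upper-high {x} x∈ = begin
      upper (residue (h + h) x)             ≡⟨ +-identityʳ _ ⟨
      upper (residue (h + h) x) + 0         ≡⟨ cong (upper (residue (h + h) x) +_) (upper-low (proj₂ x∈)) ⟨
      upper (residue (h + h) x) + upper x   ≡⟨ upper-complement (residue (h + h) x) x (residue-minus-one x∈) ⟩
      1                                     ∎

  coprime-minus-one : Coprime (h + h) n
  coprime-minus-one = ∣m∧n∣1+m⇒coprime ∣-refl ∣-refl

  jacobi-minus-square : ∀ {m s} → Coprime m n → n ∣ s * s + m → jacobi m ≡ parity h
  jacobi-minus-square {m} {s} m⊥n n∣s²+m = p+q≡r⇒p≡r+q (jacobi m) (parity h) 0ℙ (begin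
    jacobi m ℙ.+ parity h           ≡⟨ cong (jacobi m ℙ.+_) jacobi-minus-one ⟨
    jacobi m ℙ.+ jacobi (h + h)     ≡⟨ jacobi-* m⊥n coprime-minus-one ⟨
    jacobi (m * (h + h))            ≡⟨ jacobi-mod {s * s} {m * (h + h)} s²≡m[h+h] ⟨
    jacobi (s * s)                  ≡⟨ jacobi-* s⊥n s⊥n ⟩
    jacobi s ℙ.+ jacobi s           ≡⟨ ℙ.p+p≡0ℙ (jacobi s) ⟩
    0ℙ                              ∎)
    where
    open ≡-Reasoning
    s⊥n : Coprime s n
    s⊥n (g∣s , g∣n) = m⊥n (∣m+n∣m⇒∣n (∣-trans g∣n n∣s²+m) (∣m⇒∣m*n s g∣s) , g∣n)
    s²≡m[h+h] : s * s % n ≡ m * (h + h) % n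
    s²≡m[h+h] = begin
      s * s % n                      ≡⟨ [m+kn]%n≡m%n (s * s) m n ⟨
      (s * s + m * n) % n            ≡⟨ cong (λ t → (s * s + t) % n) (*-suc m (h + h)) ⟩
      (s * s + (m + m * (h + h))) % n ≡⟨ cong (_% n) (trans (sym (+-assoc (s * s) m _)) (+-comm (s * s + m) _)) ⟩
      (m * (h + h) + (s * s + m)) % n ≡⟨ %-remove-+ʳ (m * (h + h)) n∣s²+m ⟩
      m * (h + h) % n                ∎

  parity-eisenstein : ∀ {a} x → parity a ≡ 1ℙ →
                      parity x ≡ parity (absLeast (residue a x)) ℙ.+ ε a x ℙ.+ parity (a * x / n)
  parity-eisenstein {a} x a-odd = begin
    parity x                                        ≡⟨ cong (ℙ._* parity x) a-odd ⟨
    parity a ℙ.* parity x                           ≡⟨ ℙ.*-homo-* a x ⟨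
    parity (a * x)                                  ≡⟨ cong parity (m≡m%n+[m/n]*n (a * x) n) ⟩
    parity (residue a x + a * x / n * n)            ≡⟨ ℙ.+-homo-+ (residue a x) (a * x / n * n) ⟩
    parity (residue a x) ℙ.+ parity (a * x / n * n) ≡⟨ cong₂ ℙ._+_ (parity-absLeast (residue a x) (m%n≤n (a * x) n)) q*n-parity ⟩
    parity (absLeast (residue a x)) ℙ.+ ε a x ℙ.+ parity (a * x / n) ∎
    where
    open ≡-Reasoning
    q*n-parity : parity (a * x / n * n) ≡ parity (a * x / n)
    q*n-parity = trans (ℙ.*-homo-* (a * x / n) n) (trans (cong (parity (a * x / n) ℙ.*_) parity-n) (ℙ.*-identityʳ _))

  -- Summing parity-eisenstein over k, the sum of parity ⟨ k ⟩ cancels because absLeast ∘ residue a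
  -- permutes [1, h].
  jacobi-eisenstein : ∀ {a} → Coprime a n → parity a ≡ 1ℙ → jacobi a ≡ parity (∑[ k < h ] (a * ⟨ k ⟩ / n))
  jacobi-eisenstein {a} a⊥n a-odd = s≡s+j+q⇒j≡q (ℙ∑[ k < h ] parity ⟨ k ⟩) (jacobi a) (parity (∑[ k < h ] q k)) (begin
    ℙ∑[ k < h ] parity ⟨ k ⟩
      ≡⟨ ℙΣ.sum-cong-≗ {h} (λ k → parity-eisenstein {a} ⟨ k ⟩ a-odd) ⟩
    ℙ∑[ k < h ] (F k ℙ.+ ε a ⟨ k ⟩ ℙ.+ parity (q k))
      ≡⟨ ℙΣ.∑-distrib-+ {h} (λ k → F k ℙ.+ ε a ⟨ k ⟩) (parity ∘ q) ⟩
    ℙ∑[ k < h ] (F k ℙ.+ ε a ⟨ k ⟩) ℙ.+ ℙ∑[ k < h ] parity (q k)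
      ≡⟨ cong (ℙ._+ ℙ∑[ k < h ] parity (q k)) (ℙΣ.∑-distrib-+ {h} F (ε a ∘ ⟨_⟩)) ⟩
    ℙ∑[ k < h ] F k ℙ.+ ℙ∑[ k < h ] ε a ⟨ k ⟩ ℙ.+ ℙ∑[ k < h ] parity (q k)
      ≡⟨ cong₂ ℙ._+_ (cong₂ ℙ._+_ (∑-absLeast-residue a⊥n parity) (sym (jacobi-∑ a))) (sym (parity-∑ q)) ⟩
    ℙ∑[ k < h ] parity ⟨ k ⟩ ℙ.+ jacobi a ℙ.+ parity (∑[ k < h ] q k)
      ∎)
    where
    open ≡-Reasoning
    q : Fin h → ℕ
    q k = a * ⟨ k ⟩ / n
    F : Fin h → Parity
    F k = parity (absLeast (residue a ⟨ k ⟩))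

gaussCount-two : ∀ c → GaussLemma.gaussCount (suc (c + c)) 2 ≡ suc c
gaussCount-two c = +-cancelʳ-≡ c _ _ (begin
  gaussCount 2 + c
    ≡⟨ cong (gaussCount 2 +_) (count-≤ c (m≤n+m c (suc c))) ⟨
  gaussCount 2 + ∑[ k < h ] 𝟙 (does (⟨ k ⟩ ≤? c))
    ≡⟨ ∑-distrib-+ {h} (λ k → upper (residue 2 ⟨ k ⟩)) (λ k → 𝟙 (does (⟨ k ⟩ ≤? c))) ⟨
  ∑[ k < h ] (upper (residue 2 ⟨ k ⟩) + 𝟙 (does (⟨ k ⟩ ≤? c)))
    ≡⟨ sum-cong-≗ (λ k → upper-two (⟨⟩-∈ k)) ⟩
  ∑[ k < h ] 1
    ≡⟨ ∑-const h 1 ⟩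
  h * 1
    ≡⟨ *-identityʳ h ⟩
  suc c + c
    ∎)
  where
  open ≡-Reasoning
  h : ℕ
  h = suc (c + c)
  open GaussLemma h
  upper-two : ∀ {x} → x ∈[1, h ] → upper (residue 2 x) + 𝟙 (does (x ≤? c)) ≡ 1
  upper-two {x} (_ , x≤h) = begin
    upper (residue 2 x) + 𝟙 (does (x ≤? c))
      ≡⟨ cong (_+ 𝟙 (does (x ≤? c))) (upper-𝟙 (residue 2 x)) ⟩
    𝟙 (does (h <? residue 2 x)) + 𝟙 (does (x ≤? c))
      ≡⟨ cong (λ r → 𝟙 (does (h <? r)) + 𝟙 (does (x ≤? c))) residue-two ⟩
    𝟙 (does (h <? x + x)) + 𝟙 (does (x ≤? c))
      ≡⟨ cong (_+ 𝟙 (does (x ≤? c))) (𝟙-cong h<2x⇒c<x c<x⇒h<2x (h <? x + x) (c <? x)) ⟩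
    𝟙 (does (c <? x)) + 𝟙 (does (x ≤? c))
      ≡⟨ 𝟙-complement <⇒≱ ≮⇒≥ (c <? x) (x ≤? c) ⟩
    1
      ∎
    where
    residue-two : residue 2 x ≡ x + x
    residue-two = trans (m<n⇒m%n≡m (s≤s (subst (_≤ h + h) (cong (x +_) (sym (+-identityʳ x))) (+-mono-≤ x≤h x≤h))))
                        (cong (x +_) (+-identityʳ x))
    h<2x⇒c<x : h < x + x → c < x
    h<2x⇒c<x h<2x = ≰⇒> λ x≤c → <⇒≱ h<2x (≤-trans (+-mono-≤ x≤c x≤c) (n≤1+n (c + c)))
    c<x⇒h<2x : c < x → h < x + x
    c<x⇒h<2x c<x = subst (_≤ x + x) (cong suc (+-suc c c)) (+-mono-≤ c<x c<x)

-- Quadratic reciprocity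

floor-count : ∀ {m} X d .{{_ : NonZero d}} → d ∤ X → X / d ≤ m → ∑[ j < m ] 𝟙 (does (d * ⟨ j ⟩ <? X)) ≡ X / d
floor-count {m} X d d∤X X/d≤m = trans (sum-cong-≗ {m} (λ j → 𝟙-cong (below ⟨ j ⟩) (above ⟨ j ⟩) (d * ⟨ j ⟩ <? X) (⟨ j ⟩ ≤? X / d)))
                                       (count-≤ (X / d) X/d≤m)
  where
  below : ∀ y → d * y < X → y ≤ X / d
  below y dy<X = subst (_≤ X / d) (m*n/n≡m y d) (/-monoˡ-≤ d (subst (_≤ X) (*-comm d y) (<⇒≤ dy<X)))
  above : ∀ y → y ≤ X / d → d * y < X
  above y y≤X/d = ≤∧≢⇒< (≤-trans (*-monoʳ-≤ d y≤X/d) (subst (_≤ X) (*-comm (X / d) d) (m/n*n≤m X d)))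
                        (λ dy≡X → d∤X (divides y (trans (sym dy≡X) (*-comm d y))))

floor-bound : ∀ ha hn {x} → x ≤ hn → suc (ha + ha) * x / suc (hn + hn) ≤ ha
floor-bound ha hn {x} x≤hn = s≤s⁻¹ (m<n*o⇒m/o<n (begin-strict
  suc (ha + ha) * x                         ≤⟨ *-monoʳ-≤ (suc (ha + ha)) x≤hn ⟩
  suc (ha + ha) * hn                        <⟨ m<m+n _ z<s ⟩
  suc (ha + ha) * hn + suc (ha + hn)        ≡⟨ expand ha hn ⟨
  suc ha * suc (hn + hn)                    ∎))
  where
  open ≤-Reasoning
  expand : ∀ a b → suc a * suc (b + b) ≡ suc (a + a) * b + suc (a + b)
  expand = solve-∀

-- Both floor sums count lattice points of [1, ha] × [1, hn], one on each side of the line a k = n j,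
-- which passes through none of them.
lattice-count : ∀ ha hn → Coprime (suc (ha + ha)) (suc (hn + hn)) →
  ∑[ k < hn ] (suc (ha + ha) * ⟨ k ⟩ / suc (hn + hn)) + ∑[ j < ha ] (suc (hn + hn) * ⟨ j ⟩ / suc (ha + ha)) ≡ ha * hn
lattice-count ha hn a⊥n = begin
  ∑[ k < hn ] (a * ⟨ k ⟩ / n) + ∑[ j < ha ] (n * ⟨ j ⟩ / a)
    ≡⟨ cong₂ _+_ (sum-cong-≗ λ k → floor-count (a * ⟨ k ⟩) n (n∤ak k) (floor-bound ha hn (proj₂ (⟨⟩-∈ k))))
                 (sum-cong-≗ λ j → floor-count (n * ⟨ j ⟩) a (a∤nj j) (floor-bound hn ha (proj₂ (⟨⟩-∈ j)))) ⟨
  ∑[ k < hn ] ∑[ j < ha ] F j k + ∑[ j < ha ] ∑[ k < hn ] G j k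
    ≡⟨ cong (_+ ∑[ j < ha ] ∑[ k < hn ] G j k) (∑-comm (λ k j → F j k)) ⟩
  ∑[ j < ha ] ∑[ k < hn ] F j k + ∑[ j < ha ] ∑[ k < hn ] G j k
    ≡⟨ ∑-distrib-+ (λ j → ∑[ k < hn ] F j k) (λ j → ∑[ k < hn ] G j k) ⟨
  ∑[ j < ha ] (∑[ k < hn ] F j k + ∑[ k < hn ] G j k)
    ≡⟨ sum-cong-≗ row ⟩
  ∑[ j < ha ] hn
    ≡⟨ ∑-const ha hn ⟩
  ha * hn
    ∎
  where
  open ≡-Reasoning
  a n : ℕ
  a = suc (ha + ha)
  n = suc (hn + hn)
  F G : Fin ha → Fin hn → ℕ
  F j k = 𝟙 (does (n * ⟨ j ⟩ <? a * ⟨ k ⟩))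
  G j k = 𝟙 (does (a * ⟨ k ⟩ <? n * ⟨ j ⟩))
  n∤ak : ∀ (k : Fin hn) → n ∤ a * ⟨ k ⟩
  n∤ak k = coprime⇒∤* a⊥n z<s (GaussLemma.∈⇒<n hn (⟨⟩-∈ k))
  a∤nj : ∀ (j : Fin ha) → a ∤ n * ⟨ j ⟩
  a∤nj j = coprime⇒∤* (coprime-sym a⊥n) z<s (GaussLemma.∈⇒<n ha (⟨⟩-∈ j))
  F+G≡1 : ∀ j k → F j k + G j k ≡ 1
  F+G≡1 j k = 𝟙-complement <⇒≯ nj≮ak⇒ak<nj (n * ⟨ j ⟩ <? a * ⟨ k ⟩) (a * ⟨ k ⟩ <? n * ⟨ j ⟩)
    where
    nj≮ak⇒ak<nj : ¬ n * ⟨ j ⟩ < a * ⟨ k ⟩ → a * ⟨ k ⟩ < n * ⟨ j ⟩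
    nj≮ak⇒ak<nj nj≮ak = ≤∧≢⇒< (≮⇒≥ nj≮ak) (λ ak≡nj → n∤ak k (divides ⟨ j ⟩ (trans ak≡nj (*-comm n ⟨ j ⟩))))
  row : ∀ j → ∑[ k < hn ] F j k + ∑[ k < hn ] G j k ≡ hn
  row j = begin
    ∑[ k < hn ] F j k + ∑[ k < hn ] G j k ≡⟨ ∑-distrib-+ (F j) (G j) ⟨
    ∑[ k < hn ] (F j k + G j k)           ≡⟨ sum-cong-≗ (F+G≡1 j) ⟩
    ∑[ k < hn ] 1                         ≡⟨ ∑-const hn 1 ⟩
    hn * 1                                ≡⟨ *-identityʳ hn ⟩
    hn                                    ∎

reciprocity : ∀ ha hn → Coprime (suc (ha + ha)) (suc (hn + hn)) →
              GaussLemma.jacobi hn (suc (ha + ha)) ℙ.+ GaussLemma.jacobi ha (suc (hn + hn)) ≡ parity (ha * hn)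
reciprocity ha hn a⊥n = begin
  GaussLemma.jacobi hn a ℙ.+ GaussLemma.jacobi ha n
    ≡⟨ cong₂ ℙ._+_ (GaussLemma.jacobi-eisenstein hn a⊥n (GaussLemma.parity-n ha))
                   (GaussLemma.jacobi-eisenstein ha (coprime-sym a⊥n) (GaussLemma.parity-n hn)) ⟩
  parity (∑[ k < hn ] (a * ⟨ k ⟩ / n)) ℙ.+ parity (∑[ j < ha ] (n * ⟨ j ⟩ / a))
    ≡⟨ ℙ.+-homo-+ (∑[ k < hn ] (a * ⟨ k ⟩ / n)) _ ⟨
  parity (∑[ k < hn ] (a * ⟨ k ⟩ / n) + ∑[ j < ha ] (n * ⟨ j ⟩ / a))
    ≡⟨ cong parity (lattice-count ha hn a⊥n) ⟩
  parity (ha * hn)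
    ∎
  where
  open ≡-Reasoning
  a n : ℕ
  a = suc (ha + ha)
  n = suc (hn + hn)

-- Divisors of n² + n + β + 1

halve : ∀ d → ∃ λ e → d ≡ e + e ⊎ d ≡ suc (e + e)
halve zero = 0 , inj₁ refl
halve (suc d) with halve d
... | e , inj₁ d≡2e = e , inj₂ (cong suc d≡2e)
... | e , inj₂ d≡2e+1 = suc e , inj₁ (cong suc (trans d≡2e+1 (sym (+-suc e e))))

OddPart : ℕ → Set
OddPart d = ∃₂ λ j e → d ≡ 2 ^ j * suc (e + e)

odd-part : ∀ d → 0 < d → OddPart d
odd-part = <-rec (λ d → 0 < d → OddPart d) step
  where
  step : ∀ d → (∀ {d′} → d′ < d → 0 < d′ → OddPart d′) → 0 < d → OddPart d
  step d rec 0<d with halve d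
  ... | e , inj₂ d≡2e+1 = 0 , e , trans d≡2e+1 (sym (+-identityʳ _))
  ... | zero , inj₁ d≡0 = contradiction (sym d≡0) (<⇒≢ 0<d)
  ... | suc e , inj₁ d≡2e with rec (subst (suc e <_) (sym d≡2e) (m<m+n (suc e) z<s)) z<s
  ...   | j , o , e≡ = suc j , o , trans d≡2e (trans (cong₂ _+_ e≡ e≡) (double (2 ^ j) (suc (o + o))))
    where
    double : ∀ x y → x * y + x * y ≡ 2 * x * y
    double = solve-∀

2^j∣m⇒parity[j]*parity[m]≡0 : ∀ j {m} → 2 ^ j ∣ m → parity j ℙ.* parity m ≡ 0ℙ
2^j∣m⇒parity[j]*parity[m]≡0 zero _ = refl
2^j∣m⇒parity[j]*parity[m]≡0 (suc j) 2^j∣m with ∣-trans (m∣m*n {2} (2 ^ j)) 2^j∣m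
... | divides q refl = trans (cong (parity (suc j) ℙ.*_) (trans (ℙ.*-homo-* q 2) (ℙ.*-zeroʳ (parity q)))) (ℙ.*-zeroʳ _)

parity[j]*jacobi-2≡1 : ∀ hM s {N} j e → parity hM ≡ 1ℙ → 2 ^ j * suc (e + e) ∣ N →
  4 * N ≡ s * s + suc (hM + hM) → suc (hM + hM) ∣ suc (4 * (2 ^ j * suc (e + e))) →
  parity j ℙ.* GaussLemma.jacobi hM 2 ≡ 1ℙ
parity[j]*jacobi-2≡1 hM s j e hM-odd d∣N 4N≡s²+M M∣4d+1 = begin
  parity j ℙ.* χ 2                 ≡⟨ ℙ.+-identityʳ _ ⟨
  parity j ℙ.* χ 2 ℙ.+ 0ℙ          ≡⟨ cong (parity j ℙ.* χ 2 ℙ.+_) χd′≡0 ⟨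
  parity j ℙ.* χ 2 ℙ.+ χ d′        ≡⟨ cong (ℙ._+ χ d′) (jacobi-^ 2⊥M (2 + j)) ⟨
  χ (2 ^ (2 + j)) ℙ.+ χ d′         ≡⟨ jacobi-* (coprime-^ 2⊥M (2 + j)) d′⊥M ⟨
  χ (2 ^ (2 + j) * d′)             ≡⟨ cong χ (four-times (2 ^ j) d′) ⟨
  χ (4 * d)                        ≡⟨ jacobi-mod {4 * d} {hM + hM} 4d≡2hM ⟩
  χ (hM + hM)                      ≡⟨ jacobi-minus-one ⟩
  parity hM                        ≡⟨ hM-odd ⟩
  1ℙ                               ∎
  where
  open ≡-Reasoning
  open GaussLemma hM renaming (n to M; jacobi to χ)
  d′ d : ℕ
  d′ = suc (e + e)
  d = 2 ^ j * d′
  four-times : ∀ x y → 4 * (x * y) ≡ 2 * (2 * x) * y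
  four-times = solve-∀
  2⊥M : Coprime 2 M
  2⊥M = ∣m∧n∣1+m⇒coprime (∣-trans (divides 2 refl) (m∣m*n d)) M∣4d+1
  d′⊥M : Coprime d′ M
  d′⊥M = ∣m∧n∣1+m⇒coprime (∣-trans (n∣m*n (2 ^ j)) (n∣m*n 4)) M∣4d+1
  4d≡2hM : 4 * d % M ≡ (hM + hM) % M
  4d≡2hM = trans (%-pred-≡0 (n∣m⇒m%n≡0 (suc (4 * d)) M M∣4d+1)) (sym (m<n⇒m%n≡m (n<1+n (hM + hM))))
  d′∣s²+M : d′ ∣ s * s + M
  d′∣s²+M = subst (d′ ∣_) 4N≡s²+M (∣-trans (∣-trans (n∣m*n (2 ^ j)) d∣N) (n∣m*n 4))
  χ′M≡parity-e : GaussLemma.jacobi e M ≡ parity e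
  χ′M≡parity-e = GaussLemma.jacobi-minus-square e {s = s} (coprime-sym d′⊥M) d′∣s²+M
  χd′≡0 : χ d′ ≡ 0ℙ
  χd′≡0 = ℙ.+-cancelˡ-≡ (parity e) (χ d′) 0ℙ (begin
    parity e ℙ.+ χ d′              ≡⟨ cong (ℙ._+ χ d′) χ′M≡parity-e ⟨
    GaussLemma.jacobi e M ℙ.+ χ d′ ≡⟨ reciprocity hM e (coprime-sym d′⊥M) ⟩
    parity (hM * e)                ≡⟨ ℙ.*-homo-* hM e ⟩
    parity hM ℙ.* parity e         ≡⟨ cong (ℙ._* parity e) hM-odd ⟩
    parity e                       ≡⟨ ℙ.+-identityʳ (parity e) ⟨
    parity e ℙ.+ 0ℙ                ∎)

parity-n²+n : ∀ n → parity (n * n + n) ≡ 0ℙ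
parity-n²+n n = begin
  parity (n * n + n)            ≡⟨ ℙ.+-homo-+ (n * n) n ⟩
  parity (n * n) ℙ.+ parity n   ≡⟨ cong (ℙ._+ parity n) (trans (ℙ.*-homo-* n n) (ℙ.*-idem (parity n))) ⟩
  parity n ℙ.+ parity n         ≡⟨ ℙ.p+p≡0ℙ (parity n) ⟩
  0ℙ                            ∎
  where open ≡-Reasoning

parity-n²+n+β+1 : ∀ n β → parity (n * n + n + β + 1) ≡ parity (suc β)
parity-n²+n+β+1 n β = begin
  parity (n * n + n + β + 1)             ≡⟨ ℙ.+-homo-+ (n * n + n + β) 1 ⟩
  parity (n * n + n + β) ℙ.+ 1ℙ          ≡⟨ cong (ℙ._+ 1ℙ) (ℙ.+-homo-+ (n * n + n) β) ⟩
  parity (n * n + n) ℙ.+ parity β ℙ.+ 1ℙ ≡⟨ cong (λ p → p ℙ.+ parity β ℙ.+ 1ℙ) (parity-n²+n n) ⟩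
  parity β ℙ.+ 1ℙ                        ≡⟨ ℙ.+-comm (parity β) 1ℙ ⟩
  1ℙ ℙ.+ parity β                        ≡⟨ ℙ.+-homo-+ 1 β ⟨
  parity (suc β)                         ∎
  where open ≡-Reasoning

four-n²+n+β+1 : ∀ n β → 4 * (n * n + n + β + 1) ≡ suc (n + n) * suc (n + n) + suc (suc (β + β) + suc (β + β))
four-n²+n+β+1 = solve-∀

%≡3β+2⇒∣4d+1 : ∀ β d → d % suc (4 * β + 2) ≡ 3 * β + 2 → suc (suc (β + β) + suc (β + β)) ∣ suc (4 * d)
%≡3β+2⇒∣4d+1 β d d%M≡ = divides (3 + 4 * (d / M)) (begin
  suc (4 * d)                          ≡⟨ cong (λ x → suc (4 * x)) (trans (m≡m%n+[m/n]*n d M) (cong (_+ d / M * M) d%M≡)) ⟩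
  suc (4 * (3 * β + 2 + d / M * M))    ≡⟨ expand β (d / M) ⟩
  (3 + 4 * (d / M)) * suc (suc (β + β) + suc (β + β)) ∎)
  where
  open ≡-Reasoning
  M : ℕ
  M = suc (4 * β + 2)
  expand : ∀ b q → suc (4 * (3 * b + 2 + q * suc (4 * b + 2))) ≡ (3 + 4 * q) * suc (suc (b + b) + suc (b + b))
  expand = solve-∀

corollary4p3 : (n β d : ℕ) → 0 < d → d ∣ n * n + n + β + 1 →
    d % suc (4 * β + 2) ≢ 3 * β + 2
corollary4p3 n β d 0<d d∣N d%M≡3β+2 with odd-part d 0<d
... | j , e , refl = contradiction (begin
  1ℙ                                             ≡⟨ parity[j]*jacobi-2≡1 (suc (β + β)) (suc (n + n)) j e
                                                      (GaussLemma.parity-n β) d∣N (four-n²+n+β+1 n β) (%≡3β+2⇒∣4d+1 β d d%M≡3β+2) ⟨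
  parity j ℙ.* GaussLemma.jacobi (suc (β + β)) 2 ≡⟨ cong (λ c → parity j ℙ.* parity c) (gaussCount-two β) ⟩
  parity j ℙ.* parity (suc β)                    ≡⟨ cong (parity j ℙ.*_) (parity-n²+n+β+1 n β) ⟨
  parity j ℙ.* parity (n * n + n + β + 1)        ≡⟨ 2^j∣m⇒parity[j]*parity[m]≡0 j (∣-trans (m∣m*n _) d∣N) ⟩
  0ℙ                                             ∎) λ ()
  where open ≡-Reasoning
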